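{- Let $B$ be a unital algebra over a field of characteristic zero and let $f=I\cdot F\in G^I_B$ with $F\in G^{\mathrm{inv}}_B$. Then the S-transform $S_f$ satisfies $S_f=(F\circ(I\cdot S_f))^{ -1}$, and it is the unique $g\in\mathrm{Mult}[[B]]$ satisfying $g=(F\circ(I\cdot g))^{ -1}$.
   Context: $\mathrm{Mult}[[B]]$: sequences $f=(f_n)_{n\ge0}$ with $f_n:B^n\to B$ multilinear ($f_0\in B$). Product: $(f\cdot g)_n(x_1,\dots,x_n)=\sum_{k=0}^nf_k(x_1,\dots,x_k)g_{n-k}(x_{k+1},\dots,x_n)$, unit $1=(\delta_{n,0}1_B)$. Composition (for $g_0=0$): $(f\circ g)_n(x_1,\dots,x_n)=\sum_{l\ge0}\sum_{k_1+\dots+k_l=n,k_i\ge1}f_l(g_{k_1}(x_1,\dots,x_{k_1}),\dots,g_{k_l}(x_{n-k_l+1},\dots,x_n))$. $I$: $I_1=\mathrm{Id}_B$, $I_n=0$ otherwise. $G^{\mathrm{inv}}_B=\{f:f_0\in B^\times\}$ (group under $\cdot$, inverse $f^{ -1}$), $G^{\mathrm{dif}}_B=\{f:f_0=0,f_1\in GL(B)\}$ (group under $\circ$, inverse $f^{\circ-1}$), $G^I_B=I\cdot G^{\mathrm{inv}}_B$. For $f\in G^I_B$, $f^{\circ-1}\in G^I_B$, and the S-transform $S_f\in G^{\mathrm{inv}}_B$ is the unique element with $f^{\circ-1}=I\cdot S_f$. -}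

module Defs where

open import Level using (Level; _⊔_; suc)
open import Algebra.Bundles using (CommutativeRing; Ring)
open import Algebra.Module.Structures using (IsLeftModule)
open import Data.Nat using (ℕ; zero) renaming (suc to sucℕ)
open import Data.Fin using (Fin) renaming (zero to fzero)
open import Data.List using (List; []; _∷_; map; concatMap; foldr)
open import Data.Vec using (Vec; module Vec; toList; fromList; _[_]≔_; lookup)
open import Data.Vec.Relation.Binary.Pointwise.Inductive using (Pointwise)
open import Data.Product using (Σ; _×_; _,_)
open import Relation.Nullary using (¬_)

record Field (c ℓ : Level) : Set (suc (c ⊔ ℓ)) where
  field
    commutativeRing : CommutativeRing c ℓ
  open CommutativeRing commutativeRing public
  field
    0≉1     : ¬ (0# ≈ 1#)
    inverse : ∀ x → ¬ (x ≈ 0#) → Σ Carrier λ y → (x * y) ≈ 1#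

  _·1 : ℕ → Carrier
  zero ·1 = 0#
  sucℕ n ·1 = 1# + (n ·1)

CharacteristicZero : ∀ {c ℓ} → Field c ℓ → Set ℓ
CharacteristicZero K = ∀ n → ¬ ((sucℕ n ·1) ≈ 0#)
  where open Field K

record UnitalAlgebra {k kℓ} (K : Field k kℓ) (b bℓ : Level)
       : Set (suc (k ⊔ kℓ ⊔ b ⊔ bℓ)) where
  private module K = Field K
  field
    ring : Ring b bℓ
  open Ring ring public
  field
    _•_          : K.Carrier → Carrier → Carrier
    isLeftModule : IsLeftModule K.ring _≈_ _+_ 0# -_ _•_
    •-*-assocˡ   : ∀ a x y → ((a • x) * y) ≈ (a • (x * y))
    •-*-assocʳ   : ∀ a x y → (x * (a • y)) ≈ (a • (x * y))

module MultSeries {k kℓ b bℓ} {K : Field k kℓ} (B : UnitalAlgebra K b bℓ) where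
  open UnitalAlgebra B

  Seq : Set b
  Seq = (n : ℕ) → Vec Carrier n → Carrier

  IsMultilinear : ∀ {n} → (Vec Carrier n → Carrier) → Set (k ⊔ b ⊔ bℓ)
  IsMultilinear {n} φ =
      (∀ {xs ys} → Pointwise _≈_ xs ys → φ xs ≈ φ ys)
    × (∀ (xs : Vec Carrier n) (i : Fin n) y z →
         φ (xs [ i ]≔ (y + z)) ≈ (φ (xs [ i ]≔ y) + φ (xs [ i ]≔ z)))
    × (∀ (xs : Vec Carrier n) (i : Fin n) a y →
         φ (xs [ i ]≔ (a • y)) ≈ (a • φ (xs [ i ]≔ y)))

  IsMult : Seq → Set (k ⊔ b ⊔ bℓ)
  IsMult f = ∀ n → IsMultilinear (f n)

  _≋_ : Seq → Seq → Set (b ⊔ bℓ)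
  f ≋ g = ∀ n (xs : Vec Carrier n) → f n xs ≈ g n xs

  app : Seq → List Carrier → Carrier
  app f l = f _ (fromList l)

  Σ' : List Carrier → Carrier
  Σ' = foldr _+_ 0#

  splits : List Carrier → List (List Carrier × List Carrier)
  splits [] = ([] , []) ∷ []
  splits (x ∷ xs) = ([] , x ∷ xs) ∷ map (λ { (ys , zs) → (x ∷ ys , zs) }) (splits xs)

  -- all ways of cutting a list into consecutive nonempty blocks
  -- (compositions k_1 + ... + k_l = n with k_i ≥ 1)
  private
    extend : Carrier → List (List Carrier) → List (List (List Carrier))
    extend x [] = []
    extend x (bl ∷ bls) = ((x ∷ bl) ∷ bls) ∷ []

  blocks : List Carrier → List (List (List Carrier))
  blocks [] = [] ∷ []
  blocks (x ∷ xs) = concatMap (λ p → ((x ∷ []) ∷ p) ∷ extend x p) (blocks xs)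

  one : Seq
  one zero _ = 1#
  one (sucℕ _) _ = 0#

  I : Seq
  I (sucℕ zero) xs = lookup xs fzero
  I _ _ = 0#

  -- product (f·g)_n(x_1..x_n) = Σ_k f_k(x_1..x_k) g_{n-k}(x_{k+1}..x_n)
  _·_ : Seq → Seq → Seq
  (f · g) n xs = Σ' (map (λ { (ys , zs) → app f ys * app g zs }) (splits (toList xs)))

  -- composition (f∘g)_n = Σ_l Σ_{k_1+..+k_l=n, k_i≥1} f_l(g_{k_1}(..),...,g_{k_l}(..))
  _∘_ : Seq → Seq → Seq
  (f ∘ g) n xs = Σ' (map (λ p → app f (map (app g) p)) (blocks (toList xs)))

  IsInvertibleElem : Carrier → Set (b ⊔ bℓ)
  IsInvertibleElem u = Σ Carrier λ v → ((v * u) ≈ 1#) × ((u * v) ≈ 1#)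

  InGinv : Seq → Set (b ⊔ bℓ)
  InGinv f = IsInvertibleElem (f 0 Vec.[])

  IsMulInverse : Seq → Seq → Set (b ⊔ bℓ)
  IsMulInverse g h = ((g · h) ≋ one) × ((h · g) ≋ one)

  IsCompInverse : Seq → Seq → Set (b ⊔ bℓ)
  IsCompInverse g f = ((f ∘ g) ≋ I) × ((g ∘ f) ≋ I)

-- Series are handled as functions on lists (a list of length n is a point of B^n), and
-- multilinearity as linearity in each position. Composition with h = 𝕀 ⊙ ψ distributes over the
-- product and fixes h, so (𝕀 ⊙ φ) ⊚ (𝕀 ⊙ ψ) ≈ 𝕀 ⊙ (ψ ⊙ (φ ⊚ (𝕀 ⊙ ψ))); as 𝕀 ⊙ _ is cancellable,
-- 𝕀 ⊙ ψ is a right compositional inverse of 𝕀 ⊙ φ exactly when ψ solves the S-equation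
-- ψ ⊙ (φ ⊚ (𝕀 ⊙ ψ)) ≈ 𝟙. On a list xs this equation determines ψ xs from the values of ψ on
-- shorter lists, since φ [] is invertible, so it has a solution, whose constant term is invertible
-- again. Hence the right inverse has a right inverse of its own, and associativity of composition
-- makes it two-sided. If I·S is the compositional inverse of I·F, this gives both halves of
-- S = (F ∘ (I·S))⁻¹; and a solution g of the equation makes I·g a right inverse of I·F, which
-- must then equal its left inverse I·S.

module Submission where

open import Defs
open import Algebra.Bundles using (CommutativeMonoid)
open import Algebra.Module.Structures using (IsLeftModule)
open import Level using (Level; _⊔_)
open import Data.List using (List; []; _∷_; map; concatMap; foldr; _++_; length)
import Data.List.Properties as List
open import Data.List.Membership.Propositional using (_∈_)
open import Data.List.Membership.Propositional.Properties using (∈-map⁻; ∈-concat⁻′)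
open import Data.List.Relation.Unary.Any using (here; there)
open import Data.Nat as ℕ using (ℕ; zero; suc; _≤_; _<_; _≤′_; ≤′-refl; ≤′-step; z≤n; s≤s)
open import Data.Nat.Properties using (≤-trans; ≤-refl; <-≤-trans; m≤n+m; m<m+n; m≤n⇒m≤1+n; ≤⇒≤′; ≤′⇒≤)
open import Data.Fin using () renaming (zero to fzero; suc to fsuc)
open import Data.Product using (Σ; ∃₂; _×_; _,_; proj₁; proj₂; map₁)
open import Data.Vec as Vec using (Vec; toList; fromList; _[_]≔_)
open import Data.Vec.Properties using (toList∘fromList)
open import Data.Vec.Relation.Binary.Pointwise.Inductive as Pointwise using (Pointwise)
open import Relation.Binary.PropositionalEquality as ≡ using (_≡_)

-- Element-generic versions of MultSeries.splits and MultSeries.blocks: associativity of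
-- composition needs block decompositions of lists of blocks.
module _ {a} {A : Set a} where

  splits : List A → List (List A × List A)
  splits []       = ([] , []) ∷ []
  splits (x ∷ xs) = ([] , x ∷ xs) ∷ map (map₁ (x ∷_)) (splits xs)

  joinFirst : A → List (List A) → List (List (List A))
  joinFirst x []         = []
  joinFirst x (bl ∷ bls) = ((x ∷ bl) ∷ bls) ∷ []

  placements : A → List (List A) → List (List (List A))
  placements x p = ((x ∷ []) ∷ p) ∷ joinFirst x p

  blocks : List A → List (List (List A))
  blocks []       = [] ∷ []
  blocks (x ∷ xs) = concatMap (placements x) (blocks xs)

  ∈-splits⇒length : ∀ xs {s} → s ∈ splits xs →
                    length (proj₁ s) ℕ.+ length (proj₂ s) ≡ length xs
  ∈-splits⇒length []       (here ≡.refl) = ≡.refl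
  ∈-splits⇒length (x ∷ xs) (here ≡.refl) = ≡.refl
  ∈-splits⇒length (x ∷ xs) (there s∈) with ∈-map⁻ (map₁ (x ∷_)) s∈
  ... | _ , s′∈ , ≡.refl = ≡.cong suc (∈-splits⇒length xs s′∈)

  ∈-splits⇒length₂≤ : ∀ xs {s} → s ∈ splits xs → length (proj₂ s) ≤ length xs
  ∈-splits⇒length₂≤ xs {s} s∈ =
    ≡.subst (length (proj₂ s) ≤_) (∈-splits⇒length xs s∈) (m≤n+m _ (length (proj₁ s)))

  ∈-blocks⇒length≤ : ∀ xs {p bl} → p ∈ blocks xs → bl ∈ p → length bl ≤ length xs
  ∈-blocks⇒length≤ []       (here ≡.refl) ()
  ∈-blocks⇒length≤ (x ∷ xs) {p} {bl} p∈ bl∈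
    with ∈-concat⁻′ (map (placements x) (blocks xs)) p∈
  ... | _ , p∈ps , ps∈ with ∈-map⁻ (placements x) ps∈
  ... | q , q∈ , ≡.refl = placed q q∈ p∈ps bl∈
    where
    placed : ∀ q → q ∈ blocks xs → p ∈ placements x q → bl ∈ p → length bl ≤ suc (length xs)
    placed q q∈ (here ≡.refl) (here ≡.refl) = s≤s z≤n
    placed q q∈ (here ≡.refl) (there bl∈q) = m≤n⇒m≤1+n (∈-blocks⇒length≤ xs q∈ bl∈q)
    placed (bl₀ ∷ q) q∈ (there (here ≡.refl)) (here ≡.refl) =
      s≤s (∈-blocks⇒length≤ xs q∈ (here ≡.refl))
    placed (bl₀ ∷ q) q∈ (there (here ≡.refl)) (there bl∈q) =
      m≤n⇒m≤1+n (∈-blocks⇒length≤ xs q∈ (there bl∈q))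

module Reindexing {c ℓ} (M : CommutativeMonoid c ℓ) where

  open CommutativeMonoid M renaming (Carrier to C)
  open import Relation.Binary.Reasoning.Setoid setoid
  open import Algebra.Properties.CommutativeSemigroup commutativeSemigroup using (interchange)

  private
    variable
      a e : Level
      A E : Set a

  ∑ : (A → C) → List A → C
  ∑ f xs = foldr _∙_ ε (map f xs)

  ∑-cong-∈ : ∀ {f g : A → C} xs → (∀ {x} → x ∈ xs → f x ≈ g x) → ∑ f xs ≈ ∑ g xs
  ∑-cong-∈ []       f≈g = refl
  ∑-cong-∈ (x ∷ xs) f≈g = ∙-cong (f≈g (here ≡.refl)) (∑-cong-∈ xs (λ x∈ → f≈g (there x∈)))

  ∑-cong : ∀ {f g : A → C} xs → (∀ x → f x ≈ g x) → ∑ f xs ≈ ∑ g xs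
  ∑-cong xs f≈g = ∑-cong-∈ xs (λ {x} _ → f≈g x)

  ∑-++ : ∀ (f : A → C) xs ys → ∑ f (xs ++ ys) ≈ ∑ f xs ∙ ∑ f ys
  ∑-++ f []       ys = sym (identityˡ _)
  ∑-++ f (x ∷ xs) ys = trans (∙-congˡ (∑-++ f xs ys)) (sym (assoc _ _ _))

  ∑-∙ : ∀ (f g : A → C) xs → ∑ (λ x → f x ∙ g x) xs ≈ ∑ f xs ∙ ∑ g xs
  ∑-∙ f g []       = sym (identityˡ _)
  ∑-∙ f g (x ∷ xs) = trans (∙-congˡ (∑-∙ f g xs)) (interchange _ _ _ _)

  ∑-ε : ∀ {f : A → C} xs → (∀ x → f x ≈ ε) → ∑ f xs ≈ ε
  ∑-ε []       f≈ε = refl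
  ∑-ε (x ∷ xs) f≈ε = trans (∙-cong (f≈ε x) (∑-ε xs f≈ε)) (identityˡ ε)

  ∑-map : ∀ (f : A → C) (g : E → A) xs → ∑ f (map g xs) ≡ ∑ (λ x → f (g x)) xs
  ∑-map f g xs = ≡.cong (foldr _∙_ ε) (≡.sym (List.map-∘ xs))

  ∑-concatMap : ∀ (f : A → C) (g : E → List A) xs →
                ∑ f (concatMap g xs) ≈ ∑ (λ x → ∑ f (g x)) xs
  ∑-concatMap f g []       = refl
  ∑-concatMap f g (x ∷ xs) = trans (∑-++ f (g x) (concatMap g xs)) (∙-congˡ (∑-concatMap f g xs))

  ∑-comm : ∀ (f : A → E → C) xs ys →
           ∑ (λ x → ∑ (f x) ys) xs ≈ ∑ (λ y → ∑ (λ x → f x y) xs) ys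
  ∑-comm f []       ys = sym (∑-ε ys (λ _ → refl))
  ∑-comm f (x ∷ xs) ys =
    trans (∙-congˡ (∑-comm f xs ys)) (sym (∑-∙ (f x) (λ y → ∑ (λ x → f x y) xs) ys))

  ∑splits : (List A × List A → C) → List A → C
  ∑splits F xs = ∑ F (splits xs)

  ∑blocks : (List (List A) → C) → List A → C
  ∑blocks Φ xs = ∑ Φ (blocks xs)


  ∑splits-∷ : ∀ (F : List A × List A → C) x xs →
              ∑splits F (x ∷ xs) ≡ F ([] , x ∷ xs) ∙ ∑splits (λ s → F (map₁ (x ∷_) s)) xs
  ∑splits-∷ F x xs = ≡.cong (F ([] , x ∷ xs) ∙_) (∑-map F (map₁ (x ∷_)) (splits xs))

  ∑blocks-∷ : ∀ (Φ : List (List A) → C) x xs →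
              ∑blocks Φ (x ∷ xs) ≈
              ∑splits (λ s → ∑blocks (λ q → Φ ((x ∷ proj₁ s) ∷ q)) (proj₂ s)) xs
  ∑blocks-∷ Φ x []       = ∑-concatMap Φ (placements x) (blocks [])
  ∑blocks-∷ Φ x (y ∷ xs) = begin
    ∑blocks Φ (x ∷ y ∷ xs)
      ≈⟨ ∑-concatMap Φ (placements x) (blocks (y ∷ xs)) ⟩
    ∑blocks (λ p → Φ ((x ∷ []) ∷ p) ∙ ∑ Φ (joinFirst x p)) (y ∷ xs)
      ≈⟨ ∑-∙ _ _ (blocks (y ∷ xs)) ⟩
    ∑blocks (λ p → Φ ((x ∷ []) ∷ p)) (y ∷ xs) ∙ ∑blocks (λ p → ∑ Φ (joinFirst x p)) (y ∷ xs)
      ≈⟨ ∙-congˡ (∑blocks-∷ (λ p → ∑ Φ (joinFirst x p)) y xs) ⟩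
    ∑blocks (λ p → Φ ((x ∷ []) ∷ p)) (y ∷ xs) ∙
    ∑splits (λ s → ∑blocks (λ q → Φ ((x ∷ y ∷ proj₁ s) ∷ q) ∙ ε) (proj₂ s)) xs
      ≈⟨ ∙-congˡ (∑-cong (splits xs) (λ s → ∑-cong (blocks (proj₂ s)) (λ q → identityʳ _))) ⟩
    ∑blocks (λ p → Φ ((x ∷ []) ∷ p)) (y ∷ xs) ∙
    ∑splits (λ s → ∑blocks (λ q → Φ ((x ∷ y ∷ proj₁ s) ∷ q)) (proj₂ s)) xs
      ≡⟨ ≡.sym (∑splits-∷ _ y xs) ⟩
    ∑splits (λ s → ∑blocks (λ q → Φ ((x ∷ proj₁ s) ∷ q)) (proj₂ s)) (y ∷ xs) ∎

  ∑splits-assoc : ∀ (Φ : List A → List A → List A → C) xs →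
    ∑splits (λ s → ∑splits (λ t → Φ (proj₁ s) (proj₁ t) (proj₂ t)) (proj₂ s)) xs ≈
    ∑splits (λ s → ∑splits (λ t → Φ (proj₁ t) (proj₂ t) (proj₂ s)) (proj₁ s)) xs
  ∑splits-assoc Φ []       = refl
  ∑splits-assoc Φ (x ∷ xs) = begin
    ∑splits (λ s → ∑splits (λ t → Φ (proj₁ s) (proj₁ t) (proj₂ t)) (proj₂ s)) (x ∷ xs)
      ≡⟨ ∑splits-∷ _ x xs ⟩
    ∑splits (λ t → Φ [] (proj₁ t) (proj₂ t)) (x ∷ xs) ∙ L
      ≡⟨ ≡.cong (_∙ L) (∑splits-∷ _ x xs) ⟩
    (Φ [] [] (x ∷ xs) ∙ ∑splits (λ t → Φ [] (x ∷ proj₁ t) (proj₂ t)) xs) ∙ L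
      ≈⟨ ∙-congˡ (∑splits-assoc (λ us → Φ (x ∷ us)) xs) ⟩
    (Φ [] [] (x ∷ xs) ∙ ∑splits (λ t → Φ [] (x ∷ proj₁ t) (proj₂ t)) xs) ∙ R
      ≈⟨ assoc _ _ _ ⟩
    Φ [] [] (x ∷ xs) ∙ (∑splits (λ t → Φ [] (x ∷ proj₁ t) (proj₂ t)) xs ∙ R)
      ≈⟨ ∙-cong (sym (identityʳ _)) (sym (∑-∙ _ _ (splits xs))) ⟩
    (Φ [] [] (x ∷ xs) ∙ ε) ∙
    ∑splits (λ s → Φ [] (x ∷ proj₁ s) (proj₂ s) ∙
                   ∑splits (λ t → Φ (x ∷ proj₁ t) (proj₂ t) (proj₂ s)) (proj₁ s)) xs
      ≈⟨ ∙-congˡ (∑-cong (splits xs) (λ s →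
           reflexive (≡.sym (∑splits-∷ (λ t → Φ (proj₁ t) (proj₂ t) (proj₂ s)) x (proj₁ s))))) ⟩
    (Φ [] [] (x ∷ xs) ∙ ε) ∙
    ∑splits (λ s → ∑splits (λ t → Φ (proj₁ t) (proj₂ t) (proj₂ s)) (x ∷ proj₁ s)) xs
      ≡⟨ ≡.sym (∑splits-∷ _ x xs) ⟩
    ∑splits (λ s → ∑splits (λ t → Φ (proj₁ t) (proj₂ t) (proj₂ s)) (proj₁ s)) (x ∷ xs) ∎
    where
    L R : C
    L = ∑splits (λ s → ∑splits (λ t → Φ (x ∷ proj₁ s) (proj₁ t) (proj₂ t)) (proj₂ s)) xs
    R = ∑splits (λ s → ∑splits (λ t → Φ (x ∷ proj₁ t) (proj₂ t) (proj₂ s)) (proj₁ s)) xs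

  ∑blocks-∑splits : ∀ {A : Set a} (Ψ : List (List A) → List (List A) → C) xs →
    ∑blocks (λ q → ∑splits (λ t → Ψ (proj₁ t) (proj₂ t)) q) xs ≈
    ∑splits (λ s → ∑blocks (λ q₁ → ∑blocks (Ψ q₁) (proj₂ s)) (proj₁ s)) xs
  ∑blocks-∑splits {A = A} Ψ xs = bounded (length xs) xs ≤-refl Ψ
    where
    bounded : ∀ n xs → length xs ≤ n → ∀ (Ψ : List (List A) → List (List A) → C) →
      ∑blocks (λ q → ∑splits (λ t → Ψ (proj₁ t) (proj₂ t)) q) xs ≈
      ∑splits (λ s → ∑blocks (λ q₁ → ∑blocks (Ψ q₁) (proj₂ s)) (proj₁ s)) xs
    bounded n       []       _         Ψ = trans (identityʳ _) (sym (trans (identityʳ _) (identityʳ _)))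
    bounded (suc n) (x ∷ xs) (s≤s |xs|≤n) Ψ = begin
      ∑blocks (λ q → ∑splits (λ t → Ψ (proj₁ t) (proj₂ t)) q) (x ∷ xs)
        ≈⟨ ∑blocks-∷ _ x xs ⟩
      ∑splits (λ s → ∑blocks (λ q → ∑splits (λ t → Ψ (proj₁ t) (proj₂ t)) ((x ∷ proj₁ s) ∷ q)) (proj₂ s)) xs
        ≈⟨ ∑-cong (splits xs) (λ s → trans
             (∑-cong (blocks (proj₂ s)) (λ q → reflexive (∑splits-∷ _ (x ∷ proj₁ s) q)))
             (∑-∙ _ _ (blocks (proj₂ s)))) ⟩
      ∑splits (λ s → ∑blocks (λ q → Ψ [] ((x ∷ proj₁ s) ∷ q)) (proj₂ s) ∙
                     ∑blocks (λ q → ∑splits (λ t → Ψ ((x ∷ proj₁ s) ∷ proj₁ t) (proj₂ t)) q) (proj₂ s)) xs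
        ≈⟨ ∑-∙ _ _ (splits xs) ⟩
      ∑splits (λ s → ∑blocks (λ q → Ψ [] ((x ∷ proj₁ s) ∷ q)) (proj₂ s)) xs ∙
      ∑splits (λ s → ∑blocks (λ q → ∑splits (λ t → Ψ ((x ∷ proj₁ s) ∷ proj₁ t) (proj₂ t)) q) (proj₂ s)) xs
        ≈⟨ ∙-cong (sym (∑blocks-∷ _ x xs)) (∑-cong-∈ (splits xs) (λ {s} s∈ →
             bounded n (proj₂ s) (≤-trans (∈-splits⇒length₂≤ xs s∈) |xs|≤n)
               (λ q₁ q₂ → Ψ ((x ∷ proj₁ s) ∷ q₁) q₂))) ⟩
      ∑blocks (Ψ []) (x ∷ xs) ∙ ∑splits (λ s → ∑splits (λ u → T (proj₁ s) (proj₁ u) (proj₂ u)) (proj₂ s)) xs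
        ≈⟨ ∙-cong (sym (identityʳ _)) (∑splits-assoc T xs) ⟩
      (∑blocks (Ψ []) (x ∷ xs) ∙ ε) ∙ ∑splits (λ s → ∑splits (λ t → T (proj₁ t) (proj₂ t) (proj₂ s)) (proj₁ s)) xs
        ≈⟨ ∙-congˡ (∑-cong (splits xs) (λ s →
             sym (∑blocks-∷ (λ q₁ → ∑blocks (Ψ q₁) (proj₂ s)) x (proj₁ s)))) ⟩
      (∑blocks (Ψ []) (x ∷ xs) ∙ ε) ∙ ∑splits (λ s → ∑blocks (λ q₁ → ∑blocks (Ψ q₁) (proj₂ s)) (x ∷ proj₁ s)) xs
        ≡⟨ ≡.sym (∑splits-∷ _ x xs) ⟩
      ∑splits (λ s → ∑blocks (λ q₁ → ∑blocks (Ψ q₁) (proj₂ s)) (proj₁ s)) (x ∷ xs) ∎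
      where
      T : List A → List A → List A → C
      T us vs ws = ∑blocks (λ q₁ → ∑blocks (λ q₂ → Ψ ((x ∷ us) ∷ q₁) q₂) ws) vs

  ∑blocks-∑blocks-∷ : ∀ (Φ : List (List (List A)) → C) x xs →
    ∑blocks (∑blocks Φ) (x ∷ xs) ≈
    ∑splits (λ s → ∑splits (λ v →
      ∑blocks (λ c → ∑blocks (∑blocks (λ r → Φ (((x ∷ proj₁ s) ∷ c) ∷ r))) (proj₂ v)) (proj₁ v))
      (proj₂ s)) xs
  ∑blocks-∑blocks-∷ Φ x xs = begin
    ∑blocks (∑blocks Φ) (x ∷ xs)
      ≈⟨ ∑blocks-∷ (∑blocks Φ) x xs ⟩
    ∑splits (λ s → ∑blocks (λ p → ∑blocks Φ ((x ∷ proj₁ s) ∷ p)) (proj₂ s)) xs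
      ≈⟨ ∑-cong (splits xs) (λ s → ∑-cong (blocks (proj₂ s)) (λ p → ∑blocks-∷ Φ (x ∷ proj₁ s) p)) ⟩
    ∑splits (λ s → ∑blocks (λ p →
      ∑splits (λ u → ∑blocks (λ r → Φ (((x ∷ proj₁ s) ∷ proj₁ u) ∷ r)) (proj₂ u)) p) (proj₂ s)) xs
      ≈⟨ ∑-cong (splits xs) (λ s →
           ∑blocks-∑splits (λ c d → ∑blocks (λ r → Φ (((x ∷ proj₁ s) ∷ c) ∷ r)) d) (proj₂ s)) ⟩
    ∑splits (λ s → ∑splits (λ v →
      ∑blocks (λ c → ∑blocks (∑blocks (λ r → Φ (((x ∷ proj₁ s) ∷ c) ∷ r))) (proj₂ v)) (proj₁ v))
      (proj₂ s)) xs ∎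

  ∑splits-middle : ∀ (F : List A × List A → C) xs y ys →
    ∑splits F (xs ++ y ∷ ys) ≈
    ∑splits (λ s → F (proj₁ s , proj₂ s ++ y ∷ ys)) xs ∙ ∑splits (λ t → F (xs ++ y ∷ proj₁ t , proj₂ t)) ys
  ∑splits-middle F []       y ys = trans (reflexive (∑splits-∷ F y ys)) (∙-congʳ (sym (identityʳ _)))
  ∑splits-middle F (x ∷ xs) y ys = begin
    ∑splits F (x ∷ xs ++ y ∷ ys)
      ≡⟨ ∑splits-∷ F x (xs ++ y ∷ ys) ⟩
    F ([] , x ∷ xs ++ y ∷ ys) ∙ ∑splits (λ s → F (map₁ (x ∷_) s)) (xs ++ y ∷ ys)
      ≈⟨ ∙-congˡ (∑splits-middle (λ s → F (map₁ (x ∷_) s)) xs y ys) ⟩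
    F ([] , x ∷ xs ++ y ∷ ys) ∙ (∑splits (λ s → F (x ∷ proj₁ s , proj₂ s ++ y ∷ ys)) xs ∙ R)
      ≈⟨ assoc _ _ _ ⟨
    (F ([] , x ∷ xs ++ y ∷ ys) ∙ ∑splits (λ s → F (x ∷ proj₁ s , proj₂ s ++ y ∷ ys)) xs) ∙ R
      ≡⟨ ≡.cong (_∙ R) (≡.sym (∑splits-∷ (λ s → F (proj₁ s , proj₂ s ++ y ∷ ys)) x xs)) ⟩
    ∑splits (λ s → F (proj₁ s , proj₂ s ++ y ∷ ys)) (x ∷ xs) ∙ R ∎
    where
    R : C
    R = ∑splits (λ t → F (x ∷ xs ++ y ∷ proj₁ t , proj₂ t)) ys

  nonemptyRight : (List A × List A → C) → List A × List A → C
  nonemptyRight F (xs , [])     = ε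
  nonemptyRight F (xs , y ∷ ys) = F (xs , y ∷ ys)

  ∑splits-nonemptyRight : ∀ (F : List A × List A → C) xs →
                          ∑splits F xs ≈ ∑splits (nonemptyRight F) xs ∙ F (xs , [])
  ∑splits-nonemptyRight F []       =
    trans (identityʳ _) (sym (trans (∙-congʳ (identityʳ _)) (identityˡ _)))
  ∑splits-nonemptyRight F (x ∷ xs) = begin
    ∑splits F (x ∷ xs)
      ≡⟨ ∑splits-∷ F x xs ⟩
    F ([] , x ∷ xs) ∙ ∑splits (λ s → F (map₁ (x ∷_) s)) xs
      ≈⟨ ∙-congˡ (∑splits-nonemptyRight (λ s → F (map₁ (x ∷_) s)) xs) ⟩
    F ([] , x ∷ xs) ∙ (∑splits (nonemptyRight (λ s → F (map₁ (x ∷_) s))) xs ∙ F (x ∷ xs , []))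
      ≈⟨ assoc _ _ _ ⟨
    (F ([] , x ∷ xs) ∙ ∑splits (nonemptyRight (λ s → F (map₁ (x ∷_) s))) xs) ∙ F (x ∷ xs , [])
      ≈⟨ ∙-congʳ (∙-congˡ (∑-cong (splits xs) commute)) ⟩
    (F ([] , x ∷ xs) ∙ ∑splits (λ s → nonemptyRight F (map₁ (x ∷_) s)) xs) ∙ F (x ∷ xs , [])
      ≡⟨ ≡.cong (_∙ F (x ∷ xs , [])) (≡.sym (∑splits-∷ (nonemptyRight F) x xs)) ⟩
    ∑splits (nonemptyRight F) (x ∷ xs) ∙ F (x ∷ xs , []) ∎
    where
    commute : ∀ s → nonemptyRight (λ s → F (map₁ (x ∷_) s)) s ≈ nonemptyRight F (map₁ (x ∷_) s)
    commute (_ , [])    = refl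
    commute (_ , _ ∷ _) = refl

  ∑splits-first : ∀ (F : List A × List A → C) → (∀ y ys zs → F (y ∷ ys , zs) ≈ ε) →
                  ∀ xs → ∑splits F xs ≈ F ([] , xs)
  ∑splits-first F F≈ε []       = identityʳ _
  ∑splits-first F F≈ε (x ∷ xs) = begin
    ∑splits F (x ∷ xs)                                        ≡⟨ ∑splits-∷ F x xs ⟩
    F ([] , x ∷ xs) ∙ ∑splits (λ s → F (map₁ (x ∷_) s)) xs   ≈⟨ ∙-congˡ (∑-ε (splits xs) (λ s → F≈ε x _ _)) ⟩
    F ([] , x ∷ xs) ∙ ε                                       ≈⟨ identityʳ _ ⟩
    F ([] , x ∷ xs) ∎

  ∑splits-last : ∀ (F : List A × List A → C) → (∀ xs y ys → F (xs , y ∷ ys) ≈ ε) →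
                 ∀ xs → ∑splits F xs ≈ F (xs , [])
  ∑splits-last F F≈ε xs = begin
    ∑splits F xs                                 ≈⟨ ∑splits-nonemptyRight F xs ⟩
    ∑splits (nonemptyRight F) xs ∙ F (xs , [])   ≈⟨ ∙-congʳ (∑-ε (splits xs) vanish) ⟩
    ε ∙ F (xs , [])                              ≈⟨ identityˡ _ ⟩
    F (xs , []) ∎
    where
    vanish : ∀ s → nonemptyRight F s ≈ ε
    vanish (_ , [])      = refl
    vanish (xs , y ∷ ys) = F≈ε xs y ys

  ∑blocks-∷-ε : ∀ (Φ : List (List A) → C) → (∀ bl q → Φ (bl ∷ q) ≈ ε) →
                ∀ x xs → ∑blocks Φ (x ∷ xs) ≈ ε
  ∑blocks-∷-ε Φ Φ≈ε x xs = trans (∑-concatMap Φ (placements x) (blocks xs)) (∑-ε (blocks xs) vanish)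
    where
    vanish : ∀ p → ∑ Φ (placements x p) ≈ ε
    vanish []      = trans (identityʳ _) (Φ≈ε _ _)
    vanish (_ ∷ _) = trans (∙-cong (Φ≈ε _ _) (trans (identityʳ _) (Φ≈ε _ _))) (identityʳ ε)


  ∑splits-map : ∀ (F : List E × List E → C) (h : A → E) xs →
                ∑splits F (map h xs) ≈ ∑splits (λ s → F (map h (proj₁ s) , map h (proj₂ s))) xs
  ∑splits-map F h []       = refl
  ∑splits-map F h (x ∷ xs) = begin
    ∑splits F (h x ∷ map h xs)
      ≡⟨ ∑splits-∷ F (h x) (map h xs) ⟩
    F ([] , h x ∷ map h xs) ∙ ∑splits (λ s → F (map₁ (h x ∷_) s)) (map h xs)
      ≈⟨ ∙-congˡ (∑splits-map (λ s → F (map₁ (h x ∷_) s)) h xs) ⟩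
    F ([] , h x ∷ map h xs) ∙ ∑splits (λ s → F (h x ∷ map h (proj₁ s) , map h (proj₂ s))) xs
      ≡⟨ ≡.sym (∑splits-∷ _ x xs) ⟩
    ∑splits (λ s → F (map h (proj₁ s) , map h (proj₂ s))) (x ∷ xs) ∎

  ∑blocks-map : ∀ (Φ : List (List E) → C) (h : A → E) xs →
                ∑blocks Φ (map h xs) ≈ ∑blocks (λ q → Φ (map (map h) q)) xs
  ∑blocks-map Φ h []       = refl
  ∑blocks-map Φ h (x ∷ xs) = begin
    ∑blocks Φ (h x ∷ map h xs)
      ≈⟨ ∑-concatMap Φ (placements (h x)) (blocks (map h xs)) ⟩
    ∑blocks (λ p → ∑ Φ (placements (h x) p)) (map h xs)
      ≈⟨ ∑blocks-map (λ p → ∑ Φ (placements (h x) p)) h xs ⟩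
    ∑blocks (λ q → ∑ Φ (placements (h x) (map (map h) q))) xs
      ≈⟨ ∑-cong (blocks xs) placements-map ⟩
    ∑blocks (λ q → ∑ (λ q′ → Φ (map (map h) q′)) (placements x q)) xs
      ≈⟨ ∑-concatMap _ (placements x) (blocks xs) ⟨
    ∑blocks (λ q → Φ (map (map h) q)) (x ∷ xs) ∎
    where
    placements-map : ∀ q → ∑ Φ (placements (h x) (map (map h) q)) ≈
                           ∑ (λ q′ → Φ (map (map h) q′)) (placements x q)
    placements-map []      = refl
    placements-map (_ ∷ _) = refl

module Series {k kℓ b bℓ} {K : Field k kℓ} (B : UnitalAlgebra K b bℓ) where

  open UnitalAlgebra B renaming (Carrier to C)
  open MultSeries B using (IsInvertibleElem)
  open Reindexing +-commutativeMonoid public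
  open import Relation.Binary.Reasoning.Setoid setoid
  open import Algebra.Properties.CommutativeSemigroup +-commutativeSemigroup using (interchange)
  open import Algebra.Properties.AbelianGroup +-abelianGroup using (⁻¹-∙-comm; ε⁻¹≈ε; inverseʳ-unique; xyx⁻¹≈y)
  open IsLeftModule isLeftModule using (*ₗ-cong; *ₗ-zeroˡ; *ₗ-zeroʳ; *ₗ-distribˡ)
  private module K = Field K

  •-congˡ : ∀ a {y z} → y ≈ z → a • y ≈ a • z
  •-congˡ a = *ₗ-cong K.refl

  •-distrib-neg : ∀ a x → a • (- x) ≈ - (a • x)
  •-distrib-neg a x = inverseʳ-unique (a • x) (a • (- x)) (begin
    a • x + a • (- x)   ≈⟨ *ₗ-distribˡ a x (- x) ⟨
    a • (x + - x)       ≈⟨ •-congˡ a (-‿inverseʳ x) ⟩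
    a • 0#              ≈⟨ *ₗ-zeroʳ a ⟩
    0# ∎)

  record IsLinear (ψ : C → C) : Set (k ⊔ b ⊔ bℓ) where
    field
      cong   : ∀ {y z} → y ≈ z → ψ y ≈ ψ z
      +-homo : ∀ y z → ψ (y + z) ≈ ψ y + ψ z
      •-homo : ∀ a y → ψ (a • y) ≈ a • ψ y

    0#-homo : ψ 0# ≈ 0#
    0#-homo = begin
      ψ 0#           ≈⟨ cong (*ₗ-zeroˡ 0#) ⟨
      ψ (K.0# • 0#)  ≈⟨ •-homo K.0# 0# ⟩
      K.0# • ψ 0#    ≈⟨ *ₗ-zeroˡ _ ⟩
      0# ∎

    ∑-homo : ∀ {a} {A : Set a} (f : A → C) xs → ψ (∑ f xs) ≈ ∑ (λ x → ψ (f x)) xs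
    ∑-homo f []       = 0#-homo
    ∑-homo f (x ∷ xs) = trans (+-homo _ _) (+-congˡ (∑-homo f xs))

  open IsLinear

  isLinear-resp : ∀ {ψ χ} → (∀ w → ψ w ≈ χ w) → IsLinear ψ → IsLinear χ
  isLinear-resp ψ≈χ ψ-lin = record
    { cong   = λ {y} {z} y≈z → trans (sym (ψ≈χ y)) (trans (cong ψ-lin y≈z) (ψ≈χ z))
    ; +-homo = λ y z → trans (sym (ψ≈χ _)) (trans (+-homo ψ-lin y z) (+-cong (ψ≈χ y) (ψ≈χ z)))
    ; •-homo = λ a y → trans (sym (ψ≈χ _)) (trans (•-homo ψ-lin a y) (•-congˡ a (ψ≈χ y)))
    }

  isLinear-id : IsLinear (λ w → w)
  isLinear-id = record { cong = λ y≈z → y≈z ; +-homo = λ _ _ → refl ; •-homo = λ _ _ → refl }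

  isLinear-0# : IsLinear (λ _ → 0#)
  isLinear-0# = record
    { cong = λ _ → refl ; +-homo = λ _ _ → sym (+-identityˡ 0#) ; •-homo = λ a _ → sym (*ₗ-zeroʳ a) }

  isLinear-+ : ∀ {ψ χ} → IsLinear ψ → IsLinear χ → IsLinear (λ w → ψ w + χ w)
  isLinear-+ ψ-lin χ-lin = record
    { cong   = λ y≈z → +-cong (cong ψ-lin y≈z) (cong χ-lin y≈z)
    ; +-homo = λ y z → trans (+-cong (+-homo ψ-lin y z) (+-homo χ-lin y z)) (interchange _ _ _ _)
    ; •-homo = λ a y → trans (+-cong (•-homo ψ-lin a y) (•-homo χ-lin a y)) (sym (*ₗ-distribˡ a _ _))
    }

  isLinear-neg : ∀ {ψ} → IsLinear ψ → IsLinear (λ w → - ψ w)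
  isLinear-neg ψ-lin = record
    { cong   = λ y≈z → -‿cong (cong ψ-lin y≈z)
    ; +-homo = λ y z → trans (-‿cong (+-homo ψ-lin y z)) (sym (⁻¹-∙-comm _ _))
    ; •-homo = λ a y → trans (-‿cong (•-homo ψ-lin a y)) (sym (•-distrib-neg a _))
    }

  isLinear-*ʳ : ∀ {ψ} c → IsLinear ψ → IsLinear (λ w → ψ w * c)
  isLinear-*ʳ c ψ-lin = record
    { cong   = λ y≈z → *-congʳ (cong ψ-lin y≈z)
    ; +-homo = λ y z → trans (*-congʳ (+-homo ψ-lin y z)) (distribʳ c _ _)
    ; •-homo = λ a y → trans (*-congʳ (•-homo ψ-lin a y)) (•-*-assocˡ a _ c)
    }

  isLinear-*ˡ : ∀ {ψ} c → IsLinear ψ → IsLinear (λ w → c * ψ w)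
  isLinear-*ˡ c ψ-lin = record
    { cong   = λ y≈z → *-congˡ (cong ψ-lin y≈z)
    ; +-homo = λ y z → trans (*-congˡ (+-homo ψ-lin y z)) (distribˡ c _ _)
    ; •-homo = λ a y → trans (*-congˡ (•-homo ψ-lin a y)) (•-*-assocʳ a c _)
    }

  isLinear-∘ : ∀ {ψ χ} → IsLinear χ → IsLinear ψ → IsLinear (λ w → χ (ψ w))
  isLinear-∘ χ-lin ψ-lin = record
    { cong   = λ y≈z → cong χ-lin (cong ψ-lin y≈z)
    ; +-homo = λ y z → trans (cong χ-lin (+-homo ψ-lin y z)) (+-homo χ-lin _ _)
    ; •-homo = λ a y → trans (cong χ-lin (•-homo ψ-lin a y)) (•-homo χ-lin a _)
    }

  isLinear-∑-∈ : ∀ {a} {A : Set a} xs {ψ : A → C → C} → (∀ {x} → x ∈ xs → IsLinear (ψ x)) →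
                 IsLinear (λ w → ∑ (λ x → ψ x w) xs)
  isLinear-∑-∈ []       ψ-lin = isLinear-0#
  isLinear-∑-∈ (x ∷ xs) ψ-lin =
    isLinear-+ (ψ-lin (here ≡.refl)) (isLinear-∑-∈ xs (λ x∈ → ψ-lin (there x∈)))

  isLinear-∑ : ∀ {a} {A : Set a} xs {ψ : A → C → C} → (∀ x → IsLinear (ψ x)) →
               IsLinear (λ w → ∑ (λ x → ψ x w) xs)
  isLinear-∑ xs ψ-lin = isLinear-∑-∈ xs (λ {x} _ → ψ-lin x)

  Series : Set b
  Series = List C → C

  infix 4 _≈ₛ_
  _≈ₛ_ : Series → Series → Set (b ⊔ bℓ)
  f ≈ₛ g = ∀ xs → f xs ≈ g xs

  infixl 7 _⊙_
  infixr 9 _⊚_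

  _⊙_ : Series → Series → Series
  (f ⊙ g) xs = ∑splits (λ s → f (proj₁ s) * g (proj₂ s)) xs

  _⊚_ : Series → Series → Series
  (f ⊚ g) xs = ∑blocks (λ p → f (map g p)) xs

  𝕀 : Series
  𝕀 (x ∷ []) = x
  𝕀 _        = 0#

  𝟙 : Series
  𝟙 []      = 1#
  𝟙 (_ ∷ _) = 0#

  record Multilinear (f : Series) : Set (k ⊔ b ⊔ bℓ) where
    constructor multilinear
    field
      linearAt : ∀ xs ys → IsLinear (λ w → f (xs ++ w ∷ ys))

  open Multilinear

  multilinear-∷ : ∀ {f} x → Multilinear f → Multilinear (λ ys → f (x ∷ ys))
  multilinear-∷ x f-ml = multilinear (λ xs ys → linearAt f-ml (x ∷ xs) ys)

  multilinear-cong-map : ∀ {a} {A : Set a} {f} → Multilinear f → ∀ {h h′ : A → C} p →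
                         (∀ {x} → x ∈ p → h x ≈ h′ x) → f (map h p) ≈ f (map h′ p)
  multilinear-cong-map f-ml []      h≈h′ = refl
  multilinear-cong-map f-ml {h} {h′} (x ∷ p) h≈h′ =
    trans (cong (linearAt f-ml [] (map h p)) (h≈h′ (here ≡.refl)))
          (multilinear-cong-map (multilinear-∷ (h′ x) f-ml) p (λ x∈ → h≈h′ (there x∈)))

  𝟙-multilinear : Multilinear 𝟙
  𝟙-multilinear = multilinear linear
    where
    linear : ∀ xs ys → IsLinear (λ w → 𝟙 (xs ++ w ∷ ys))
    linear []      _ = isLinear-0#
    linear (_ ∷ _) _ = isLinear-0#

  𝕀-multilinear : Multilinear 𝕀
  𝕀-multilinear = multilinear linear
    where
    linear : ∀ xs ys → IsLinear (λ w → 𝕀 (xs ++ w ∷ ys))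
    linear []          []      = isLinear-id
    linear []          (_ ∷ _) = isLinear-0#
    linear (_ ∷ [])    _       = isLinear-0#
    linear (_ ∷ _ ∷ _) _       = isLinear-0#

  ⊙-multilinear : ∀ {f g} → Multilinear f → Multilinear g → Multilinear (f ⊙ g)
  ⊙-multilinear f-ml g-ml = multilinear λ xs ys →
    isLinear-resp (λ w → sym (∑splits-middle _ xs w ys))
      (isLinear-+ (isLinear-∑ (splits xs) (λ s → isLinear-*ˡ _ (linearAt g-ml (proj₂ s) ys)))
                  (isLinear-∑ (splits ys) (λ t → isLinear-*ʳ _ (linearAt f-ml xs (proj₁ t)))))

  𝕀⊙-multilinear : ∀ {f} → Multilinear f → Multilinear (𝕀 ⊙ f)
  𝕀⊙-multilinear = ⊙-multilinear 𝕀-multilinear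

  ⊚-multilinear : ∀ {f h} → Multilinear f → Multilinear h → Multilinear (f ⊚ h)
  ⊚-multilinear {h = h} f-ml h-ml = multilinear λ xs ys → bounded ys (length xs) xs ≤-refl f-ml
    where
    bounded : ∀ ys n xs → length xs ≤ n → ∀ {f} → Multilinear f →
              IsLinear (λ w → (f ⊚ h) (xs ++ w ∷ ys))
    bounded ys n [] _ f-ml =
      isLinear-resp (λ w → sym (∑blocks-∷ _ w ys))
        (isLinear-∑ (splits ys) (λ s → isLinear-∑ (blocks (proj₂ s)) (λ q →
           isLinear-∘ (linearAt f-ml [] (map h q)) (linearAt h-ml [] (proj₁ s)))))
    bounded ys (suc n) (x ∷ xs) (s≤s |xs|≤n) f-ml =
      isLinear-resp (λ w → sym (trans (∑blocks-∷ _ x (xs ++ w ∷ ys)) (∑splits-middle _ xs w ys)))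
        (isLinear-+
          (isLinear-∑-∈ (splits xs) (λ {s} s∈ →
             bounded ys n (proj₂ s) (≤-trans (∈-splits⇒length₂≤ xs s∈) |xs|≤n)
               (multilinear-∷ (h (x ∷ proj₁ s)) f-ml)))
          (isLinear-∑ (splits ys) (λ t → isLinear-∑ (blocks (proj₂ t)) (λ q →
             isLinear-∘ (linearAt f-ml [] (map h q)) (linearAt h-ml (x ∷ xs) (proj₁ t))))))

  *-distribˡ-∑ : ∀ {a} {A : Set a} c (f : A → C) xs → c * ∑ f xs ≈ ∑ (λ x → c * f x) xs
  *-distribˡ-∑ c f []       = zeroʳ c
  *-distribˡ-∑ c f (x ∷ xs) = trans (distribˡ c _ _) (+-congˡ (*-distribˡ-∑ c f xs))

  *-distribʳ-∑ : ∀ {a} {A : Set a} c (f : A → C) xs → ∑ f xs * c ≈ ∑ (λ x → f x * c) xs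
  *-distribʳ-∑ c f []       = zeroˡ c
  *-distribʳ-∑ c f (x ∷ xs) = trans (distribʳ c _ _) (+-congˡ (*-distribʳ-∑ c f xs))

  ⊙-cong : ∀ {f f′ g g′} → f ≈ₛ f′ → g ≈ₛ g′ → f ⊙ g ≈ₛ f′ ⊙ g′
  ⊙-cong f≈f′ g≈g′ xs = ∑-cong (splits xs) (λ s → *-cong (f≈f′ _) (g≈g′ _))

  ⊙-congˡ : ∀ {f g g′} → g ≈ₛ g′ → f ⊙ g ≈ₛ f ⊙ g′
  ⊙-congˡ = ⊙-cong (λ _ → refl)

  ⊙-congʳ : ∀ {f f′ g} → f ≈ₛ f′ → f ⊙ g ≈ₛ f′ ⊙ g
  ⊙-congʳ f≈f′ = ⊙-cong f≈f′ (λ _ → refl)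

  ⊚-congʳ : ∀ {f f′} h → f ≈ₛ f′ → f ⊚ h ≈ₛ f′ ⊚ h
  ⊚-congʳ h f≈f′ xs = ∑-cong (blocks xs) (λ p → f≈f′ _)

  ⊚-congˡ : ∀ {f} → Multilinear f → ∀ {h h′} → h ≈ₛ h′ → f ⊚ h ≈ₛ f ⊚ h′
  ⊚-congˡ f-ml h≈h′ xs = ∑-cong (blocks xs) (λ p → multilinear-cong-map f-ml p (λ {x} _ → h≈h′ x))

  ⊙-identityˡ : ∀ f → 𝟙 ⊙ f ≈ₛ f
  ⊙-identityˡ f xs = trans (∑splits-first _ (λ _ _ _ → zeroˡ _) xs) (*-identityˡ _)

  ⊙-identityʳ : ∀ f → f ⊙ 𝟙 ≈ₛ f
  ⊙-identityʳ f xs = trans (∑splits-last _ (λ _ _ _ → zeroʳ _) xs) (*-identityʳ _)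

  ⊙-assoc : ∀ f g h → (f ⊙ g) ⊙ h ≈ₛ f ⊙ (g ⊙ h)
  ⊙-assoc f g h xs = begin
    ∑splits (λ s → ∑splits (λ t → f (proj₁ t) * g (proj₂ t)) (proj₁ s) * h (proj₂ s)) xs
      ≈⟨ ∑-cong (splits xs) (λ s → *-distribʳ-∑ _ _ (splits (proj₁ s))) ⟩
    ∑splits (λ s → ∑splits (λ t → (f (proj₁ t) * g (proj₂ t)) * h (proj₂ s)) (proj₁ s)) xs
      ≈⟨ ∑-cong (splits xs) (λ s → ∑-cong (splits (proj₁ s)) (λ t → *-assoc _ _ _)) ⟩
    ∑splits (λ s → ∑splits (λ t → f (proj₁ t) * (g (proj₂ t) * h (proj₂ s))) (proj₁ s)) xs
      ≈⟨ ∑splits-assoc (λ us vs ws → f us * (g vs * h ws)) xs ⟨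
    ∑splits (λ s → ∑splits (λ t → f (proj₁ s) * (g (proj₁ t) * h (proj₂ t))) (proj₂ s)) xs
      ≈⟨ ∑-cong (splits xs) (λ s → *-distribˡ-∑ _ _ (splits (proj₂ s))) ⟨
    ∑splits (λ s → f (proj₁ s) * ∑splits (λ t → g (proj₁ t) * h (proj₂ t)) (proj₂ s)) xs ∎

  ⊚-distribʳ-⊙ : ∀ f g h → (f ⊙ g) ⊚ h ≈ₛ (f ⊚ h) ⊙ (g ⊚ h)
  ⊚-distribʳ-⊙ f g h xs = begin
    ∑blocks (λ q → ∑splits (λ s → f (proj₁ s) * g (proj₂ s)) (map h q)) xs
      ≈⟨ ∑-cong (blocks xs) (λ q → ∑splits-map _ h q) ⟩
    ∑blocks (λ q → ∑splits (λ t → f (map h (proj₁ t)) * g (map h (proj₂ t))) q) xs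
      ≈⟨ ∑blocks-∑splits (λ q₁ q₂ → f (map h q₁) * g (map h q₂)) xs ⟩
    ∑splits (λ s → ∑blocks (λ q₁ → ∑blocks (λ q₂ → f (map h q₁) * g (map h q₂)) (proj₂ s)) (proj₁ s)) xs
      ≈⟨ ∑-cong (splits xs) (λ s → trans
           (∑-cong (blocks (proj₁ s)) (λ q₁ → sym (*-distribˡ-∑ _ _ (blocks (proj₂ s)))))
           (sym (*-distribʳ-∑ _ _ (blocks (proj₁ s))))) ⟩
    ∑splits (λ s → (f ⊚ h) (proj₁ s) * (g ⊚ h) (proj₂ s)) xs ∎

  𝟙-⊚ : ∀ h → 𝟙 ⊚ h ≈ₛ 𝟙
  𝟙-⊚ h []       = +-identityʳ _
  𝟙-⊚ h (x ∷ xs) = ∑blocks-∷-ε _ (λ _ _ → refl) x xs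

  ⊚-identityˡ : ∀ h → h [] ≈ 0# → 𝕀 ⊚ h ≈ₛ h
  ⊚-identityˡ h h[]≈0 []       = trans (+-identityʳ _) (sym h[]≈0)
  ⊚-identityˡ h h[]≈0 (x ∷ xs) = begin
    (𝕀 ⊚ h) (x ∷ xs)
      ≈⟨ ∑blocks-∷ _ x xs ⟩
    ∑splits (λ s → ∑blocks (λ q → 𝕀 (h (x ∷ proj₁ s) ∷ map h q)) (proj₂ s)) xs
      ≈⟨ ∑splits-last _ (λ _ y ys → ∑blocks-∷-ε _ (λ _ _ → refl) y ys) xs ⟩
    h (x ∷ xs) + 0#
      ≈⟨ +-identityʳ _ ⟩
    h (x ∷ xs) ∎

  ⊚-identityʳ : ∀ {f} → Multilinear f → f ⊚ 𝕀 ≈ₛ f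
  ⊚-identityʳ f-ml []       = +-identityʳ _
  ⊚-identityʳ {f} f-ml (x ∷ xs) = begin
    (f ⊚ 𝕀) (x ∷ xs)
      ≈⟨ ∑blocks-∷ _ x xs ⟩
    ∑splits (λ s → ∑blocks (λ q → f (𝕀 (x ∷ proj₁ s) ∷ map 𝕀 q)) (proj₂ s)) xs
      ≈⟨ ∑splits-first _ (λ _ _ zs → ∑-ε (blocks zs) (λ q → 0#-homo (linearAt f-ml [] (map 𝕀 q)))) xs ⟩
    ((λ ys → f (x ∷ ys)) ⊚ 𝕀) xs
      ≈⟨ ⊚-identityʳ (multilinear-∷ x f-ml) xs ⟩
    f (x ∷ xs) ∎

  𝕀⊙-[] : ∀ f → (𝕀 ⊙ f) [] ≈ 0#
  𝕀⊙-[] f = trans (+-identityʳ _) (zeroˡ _)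

  𝕀⊙-∷ : ∀ f x xs → (𝕀 ⊙ f) (x ∷ xs) ≈ x * f xs
  𝕀⊙-∷ f x xs = begin
    (𝕀 ⊙ f) (x ∷ xs)
      ≡⟨ ∑splits-∷ _ x xs ⟩
    0# * f (x ∷ xs) + ∑splits (λ t → 𝕀 (x ∷ proj₁ t) * f (proj₂ t)) xs
      ≈⟨ +-cong (zeroˡ _) (∑splits-first _ (λ _ _ _ → zeroˡ _) xs) ⟩
    0# + x * f xs
      ≈⟨ +-identityˡ _ ⟩
    x * f xs ∎

  𝕀⊙-cancel : ∀ {f g} → 𝕀 ⊙ f ≈ₛ 𝕀 ⊙ g → f ≈ₛ g
  𝕀⊙-cancel {f} {g} 𝕀f≈𝕀g xs = begin
    f xs               ≈⟨ *-identityˡ _ ⟨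
    1# * f xs          ≈⟨ 𝕀⊙-∷ f 1# xs ⟨
    (𝕀 ⊙ f) (1# ∷ xs)  ≈⟨ 𝕀f≈𝕀g (1# ∷ xs) ⟩
    (𝕀 ⊙ g) (1# ∷ xs)  ≈⟨ 𝕀⊙-∷ g 1# xs ⟩
    1# * g xs          ≈⟨ *-identityˡ _ ⟩
    g xs ∎

  multilinear-∑blocks-∷ : ∀ {f} → Multilinear f → ∀ {a} {A : Set a} (G : List (List A) → C) x ys zs →
    f (∑blocks G (x ∷ ys) ∷ zs) ≈
    ∑splits (λ t → ∑blocks (λ p → f (G ((x ∷ proj₁ t) ∷ p) ∷ zs)) (proj₂ t)) ys
  multilinear-∑blocks-∷ {f} f-ml G x ys zs = begin
    f (∑blocks G (x ∷ ys) ∷ zs)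
      ≈⟨ cong f-lin (∑blocks-∷ G x ys) ⟩
    f (∑splits (λ t → ∑blocks (λ p → G ((x ∷ proj₁ t) ∷ p)) (proj₂ t)) ys ∷ zs)
      ≈⟨ ∑-homo f-lin _ (splits ys) ⟩
    ∑splits (λ t → f (∑blocks (λ p → G ((x ∷ proj₁ t) ∷ p)) (proj₂ t) ∷ zs)) ys
      ≈⟨ ∑-cong (splits ys) (λ t → ∑-homo f-lin _ (blocks (proj₂ t))) ⟩
    ∑splits (λ t → ∑blocks (λ p → f (G ((x ∷ proj₁ t) ∷ p) ∷ zs)) (proj₂ t)) ys ∎
    where
    f-lin : IsLinear (λ w → f (w ∷ zs))
    f-lin = linearAt f-ml [] zs

  ∑blocks-refine : ∀ {f} → Multilinear f → ∀ {a} {A : Set a} (G : List (List A) → C) xs →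
    ∑blocks (∑blocks (λ r → f (map G r))) xs ≈ ∑blocks (λ q → f (map (∑blocks G) q)) xs
  ∑blocks-refine f-ml {A = A} G xs = bounded (length xs) xs ≤-refl f-ml
    where
    bounded : ∀ n xs → length xs ≤ n → ∀ {f} → Multilinear f →
      ∑blocks (∑blocks (λ r → f (map G r))) xs ≈ ∑blocks (λ q → f (map (∑blocks G) q)) xs
    bounded n       []       _          f-ml = +-identityʳ _
    bounded (suc n) (x ∷ xs) (s≤s |xs|≤n) {f} f-ml = begin
      ∑blocks (∑blocks (λ r → f (map G r))) (x ∷ xs)
        ≈⟨ ∑blocks-∑blocks-∷ (λ r → f (map G r)) x xs ⟩
      ∑splits (λ s → ∑splits (λ v → ∑blocks (λ c →
        ∑blocks (∑blocks (λ r → f (G ((x ∷ proj₁ s) ∷ c) ∷ map G r))) (proj₂ v)) (proj₁ v)) (proj₂ s)) xs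
        ≈⟨ ∑-cong-∈ (splits xs) (λ {s} s∈ → ∑-cong-∈ (splits (proj₂ s)) (λ {v} v∈ →
             ∑-cong (blocks (proj₁ v)) (λ c →
               bounded n (proj₂ v)
                 (≤-trans (∈-splits⇒length₂≤ (proj₂ s) v∈) (≤-trans (∈-splits⇒length₂≤ xs s∈) |xs|≤n))
                 (multilinear-∷ (G ((x ∷ proj₁ s) ∷ c)) f-ml)))) ⟩
      ∑splits (λ s → ∑splits (λ v → T (proj₁ s) (proj₁ v) (proj₂ v)) (proj₂ s)) xs
        ≈⟨ ∑splits-assoc T xs ⟩
      ∑splits (λ s → ∑splits (λ t → T (proj₁ t) (proj₂ t) (proj₂ s)) (proj₁ s)) xs
        ≈⟨ expand-first-block ⟨
      ∑blocks (λ q → f (map (∑blocks G) q)) (x ∷ xs) ∎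
      where
      W : List A → List (List A) → List (List A) → C
      W us c q = f (G ((x ∷ us) ∷ c) ∷ map (∑blocks G) q)

      T : List A → List A → List A → C
      T us vs ws = ∑blocks (λ c → ∑blocks (W us c) ws) vs

      expand-first-block : ∑blocks (λ q → f (map (∑blocks G) q)) (x ∷ xs) ≈
                           ∑splits (λ s → ∑splits (λ t → T (proj₁ t) (proj₂ t) (proj₂ s)) (proj₁ s)) xs
      expand-first-block = begin
        ∑blocks (λ q → f (map (∑blocks G) q)) (x ∷ xs)
          ≈⟨ ∑blocks-∷ _ x xs ⟩
        ∑splits (λ s → ∑blocks (λ q → f (∑blocks G (x ∷ proj₁ s) ∷ map (∑blocks G) q)) (proj₂ s)) xs
          ≈⟨ ∑-cong (splits xs) (λ s → ∑-cong (blocks (proj₂ s)) (λ q →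
               multilinear-∑blocks-∷ f-ml G x (proj₁ s) (map (∑blocks G) q))) ⟩
        ∑splits (λ s → ∑blocks (λ q →
          ∑splits (λ t → ∑blocks (λ c → W (proj₁ t) c q) (proj₂ t)) (proj₁ s)) (proj₂ s)) xs
          ≈⟨ ∑-cong (splits xs) (λ s → ∑-comm _ (blocks (proj₂ s)) (splits (proj₁ s))) ⟩
        ∑splits (λ s → ∑splits (λ t →
          ∑blocks (λ q → ∑blocks (λ c → W (proj₁ t) c q) (proj₂ t)) (proj₂ s)) (proj₁ s)) xs
          ≈⟨ ∑-cong (splits xs) (λ s → ∑-cong (splits (proj₁ s)) (λ t →
               ∑-comm _ (blocks (proj₂ s)) (blocks (proj₂ t)))) ⟩
        ∑splits (λ s → ∑splits (λ t → T (proj₁ t) (proj₂ t) (proj₂ s)) (proj₁ s)) xs ∎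

  ⊚-assoc : ∀ {f} → Multilinear f → ∀ g h → (f ⊚ g) ⊚ h ≈ₛ f ⊚ (g ⊚ h)
  ⊚-assoc {f} f-ml g h xs = begin
    ∑blocks (λ p → ∑blocks (λ r → f (map g r)) (map h p)) xs
      ≈⟨ ∑-cong (blocks xs) (λ p → ∑blocks-map _ h p) ⟩
    ∑blocks (λ p → ∑blocks (λ r → f (map g (map (map h) r))) p) xs
      ≈⟨ ∑-cong (blocks xs) (λ p → ∑-cong (blocks p) (λ r → reflexive (≡.cong f (≡.sym (List.map-∘ r))))) ⟩
    ∑blocks (∑blocks (λ r → f (map (λ t → g (map h t)) r))) xs
      ≈⟨ ∑blocks-refine f-ml (λ t → g (map h t)) xs ⟩
    (f ⊚ (g ⊚ h)) xs ∎

  𝕀⊙-⊚-𝕀⊙ : ∀ φ ψ → (𝕀 ⊙ φ) ⊚ (𝕀 ⊙ ψ) ≈ₛ 𝕀 ⊙ (ψ ⊙ (φ ⊚ (𝕀 ⊙ ψ)))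
  𝕀⊙-⊚-𝕀⊙ φ ψ xs = begin
    ((𝕀 ⊙ φ) ⊚ (𝕀 ⊙ ψ)) xs                ≈⟨ ⊚-distribʳ-⊙ 𝕀 φ (𝕀 ⊙ ψ) xs ⟩
    ((𝕀 ⊚ (𝕀 ⊙ ψ)) ⊙ (φ ⊚ (𝕀 ⊙ ψ))) xs    ≈⟨ ⊙-congʳ (⊚-identityˡ (𝕀 ⊙ ψ) (𝕀⊙-[] ψ)) xs ⟩
    ((𝕀 ⊙ ψ) ⊙ (φ ⊚ (𝕀 ⊙ ψ))) xs          ≈⟨ ⊙-assoc 𝕀 ψ (φ ⊚ (𝕀 ⊙ ψ)) xs ⟩
    (𝕀 ⊙ (ψ ⊙ (φ ⊚ (𝕀 ⊙ ψ)))) xs ∎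

  S-equation⇒⊚-inverseʳ : ∀ {φ ψ} → ψ ⊙ (φ ⊚ (𝕀 ⊙ ψ)) ≈ₛ 𝟙 → (𝕀 ⊙ φ) ⊚ (𝕀 ⊙ ψ) ≈ₛ 𝕀
  S-equation⇒⊚-inverseʳ {φ} {ψ} eq xs =
    trans (𝕀⊙-⊚-𝕀⊙ φ ψ xs) (trans (⊙-congˡ eq xs) (⊙-identityʳ 𝕀 xs))

  ⊚-inverseʳ⇒S-equation : ∀ {φ ψ} → (𝕀 ⊙ φ) ⊚ (𝕀 ⊙ ψ) ≈ₛ 𝕀 → ψ ⊙ (φ ⊚ (𝕀 ⊙ ψ)) ≈ₛ 𝟙
  ⊚-inverseʳ⇒S-equation {φ} {ψ} inv = 𝕀⊙-cancel (λ xs →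
    trans (sym (𝕀⊙-⊚-𝕀⊙ φ ψ xs)) (trans (inv xs) (sym (⊙-identityʳ 𝕀 xs))))

  ⊙-inverse-unique : ∀ {f g h} → f ⊙ g ≈ₛ 𝟙 → g ⊙ h ≈ₛ 𝟙 → f ≈ₛ h
  ⊙-inverse-unique {f} {g} {h} fg≈𝟙 gh≈𝟙 xs = begin
    f xs              ≈⟨ ⊙-identityʳ f xs ⟨
    (f ⊙ 𝟙) xs        ≈⟨ ⊙-congˡ gh≈𝟙 xs ⟨
    (f ⊙ (g ⊙ h)) xs  ≈⟨ ⊙-assoc f g h xs ⟨
    ((f ⊙ g) ⊙ h) xs  ≈⟨ ⊙-congʳ fg≈𝟙 xs ⟩
    (𝟙 ⊙ h) xs        ≈⟨ ⊙-identityˡ h xs ⟩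
    h xs ∎

  ⊚-inverse-unique : ∀ {f g h} → Multilinear f → h [] ≈ 0# → f ⊚ g ≈ₛ 𝕀 → g ⊚ h ≈ₛ 𝕀 → h ≈ₛ f
  ⊚-inverse-unique {f} {g} {h} f-ml h[]≈0 fg≈𝕀 gh≈𝕀 xs = begin
    h xs              ≈⟨ ⊚-identityˡ h h[]≈0 xs ⟨
    (𝕀 ⊚ h) xs        ≈⟨ ⊚-congʳ h fg≈𝕀 xs ⟨
    ((f ⊚ g) ⊚ h) xs  ≈⟨ ⊚-assoc f-ml g h xs ⟩
    (f ⊚ (g ⊚ h)) xs  ≈⟨ ⊚-congˡ f-ml gh≈𝕀 xs ⟩
    (f ⊚ 𝕀) xs        ≈⟨ ⊚-identityʳ f-ml xs ⟩
    f xs ∎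

  𝕀⊙-local : ∀ {f g} n → (∀ xs → length xs < n → f xs ≈ g xs) →
             ∀ xs → length xs ≤ n → (𝕀 ⊙ f) xs ≈ (𝕀 ⊙ g) xs
  𝕀⊙-local {f} {g} n f≈g []       _        = trans (𝕀⊙-[] f) (sym (𝕀⊙-[] g))
  𝕀⊙-local {f} {g} n f≈g (x ∷ xs) |xs|<n =
    trans (𝕀⊙-∷ f x xs) (trans (*-congˡ (f≈g xs |xs|<n)) (sym (𝕀⊙-∷ g x xs)))

  -- At xs the S-equation reads rest ψ xs + ψ xs * φ [] ≈ 𝟙 xs, where rest ψ xs involves ψ only on
  -- shorter lists (rest-local). So ψ is defined by recursion on the length, realised as the value
  -- at which the iteration of T ↦ step T stabilises (iterate-stable).
  module SEquationSolution {φ : Series} (φ-ml : Multilinear φ)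
                           (c : C) (c*φ[]≈1 : c * φ [] ≈ 1#) where

    φ∘𝕀⊙ : Series → Series
    φ∘𝕀⊙ T = φ ⊚ (𝕀 ⊙ T)

    rest : Series → Series
    rest T = ∑splits (nonemptyRight (λ s → T (proj₁ s) * φ∘𝕀⊙ T (proj₂ s)))

    step : Series → Series
    step T xs = (𝟙 xs + - rest T xs) * c

    iterate : ℕ → Series
    iterate zero    _ = 0#
    iterate (suc m)   = step (iterate m)

    ψ : Series
    ψ xs = iterate (suc (length xs)) xs

    ⊙-φ∘𝕀⊙ : ∀ T xs → (T ⊙ φ∘𝕀⊙ T) xs ≈ rest T xs + T xs * φ []
    ⊙-φ∘𝕀⊙ T xs = trans (∑splits-nonemptyRight _ xs) (+-congˡ (*-congˡ (+-identityʳ _)))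

    rest-multilinear : ∀ {T} → Multilinear T → Multilinear (rest T)
    rest-multilinear {T} T-ml = multilinear λ xs ys →
      isLinear-resp (λ w → sym (rest≈ (xs ++ w ∷ ys)))
        (isLinear-+ (linearAt (⊙-multilinear T-ml (⊚-multilinear φ-ml (𝕀⊙-multilinear T-ml))) xs ys)
                    (isLinear-neg (isLinear-*ʳ (φ []) (linearAt T-ml xs ys))))
      where
      rest≈ : ∀ xs → rest T xs ≈ (T ⊙ φ∘𝕀⊙ T) xs + - (T xs * φ [])
      rest≈ xs = begin
        rest T xs                                       ≈⟨ xyx⁻¹≈y (T xs * φ []) (rest T xs) ⟨
        T xs * φ [] + rest T xs + - (T xs * φ [])       ≈⟨ +-congʳ (+-comm _ _) ⟩
        rest T xs + T xs * φ [] + - (T xs * φ [])       ≈⟨ +-congʳ (⊙-φ∘𝕀⊙ T xs) ⟨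
        (T ⊙ φ∘𝕀⊙ T) xs + - (T xs * φ []) ∎

    iterate-multilinear : ∀ m → Multilinear (iterate m)
    iterate-multilinear zero    = multilinear (λ _ _ → isLinear-0#)
    iterate-multilinear (suc m) = multilinear λ xs ys →
      isLinear-*ʳ c (isLinear-+ (linearAt 𝟙-multilinear xs ys)
                                (isLinear-neg (linearAt (rest-multilinear (iterate-multilinear m)) xs ys)))

    ψ-multilinear : Multilinear ψ
    ψ-multilinear = multilinear λ xs ys →
      isLinear-resp (λ w → reflexive (≡.cong (λ n → iterate (suc n) (xs ++ w ∷ ys)) (≡.sym (List.length-++ xs))))
        (linearAt (iterate-multilinear (suc (length xs ℕ.+ suc (length ys)))) xs ys)

    rest-local : ∀ {T T′} xs → (∀ ys → length ys < length xs → T ys ≈ T′ ys) → rest T xs ≈ rest T′ xs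
    rest-local {T} {T′} xs T≈T′ = ∑-cong-∈ (splits xs) agree
      where
      agree : ∀ {s} → s ∈ splits xs →
              nonemptyRight (λ s → T (proj₁ s) * φ∘𝕀⊙ T (proj₂ s)) s ≈
              nonemptyRight (λ s → T′ (proj₁ s) * φ∘𝕀⊙ T′ (proj₂ s)) s
      agree {_ , []}         _  = refl
      agree {ys , z ∷ zs} s∈ = *-cong (T≈T′ ys |ys|<|xs|)
        (∑-cong-∈ (blocks (z ∷ zs)) (λ {p} p∈ → multilinear-cong-map φ-ml p (λ {bl} bl∈ →
           𝕀⊙-local (length xs) T≈T′ bl
             (≤-trans (∈-blocks⇒length≤ (z ∷ zs) p∈ bl∈) (∈-splits⇒length₂≤ xs s∈)))))
        where
        |ys|<|xs| : length ys < length xs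
        |ys|<|xs| = ≡.subst (length ys <_) (∈-splits⇒length xs s∈) (m<m+n (length ys) (s≤s z≤n))

    iterate-stable : ∀ m xs → length xs < m → iterate m xs ≈ iterate (suc m) xs
    iterate-stable (suc m) xs (s≤s |xs|≤m) =
      *-congʳ (+-congˡ (-‿cong (rest-local xs (λ ys |ys|<|xs| →
        iterate-stable m ys (<-≤-trans |ys|<|xs| |xs|≤m)))))

    iterate-stable′ : ∀ {m n} xs → length xs < m → m ≤′ n → iterate m xs ≈ iterate n xs
    iterate-stable′ xs |xs|<m ≤′-refl         = refl
    iterate-stable′ xs |xs|<m (≤′-step m≤′n) =
      trans (iterate-stable′ xs |xs|<m m≤′n) (iterate-stable _ xs (<-≤-trans |xs|<m (≤′⇒≤ m≤′n)))

    ψ-solves : ψ ⊙ φ∘𝕀⊙ ψ ≈ₛ 𝟙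
    ψ-solves xs = begin
      (ψ ⊙ φ∘𝕀⊙ ψ) xs                ≈⟨ ⊙-φ∘𝕀⊙ ψ xs ⟩
      rest ψ xs + ψ xs * φ []        ≈⟨ +-congʳ (rest-local xs ψ≈iterate) ⟩
      R + ((𝟙 xs + - R) * c) * φ []  ≈⟨ +-congˡ (trans (*-assoc _ _ _) (trans (*-congˡ c*φ[]≈1) (*-identityʳ _))) ⟩
      R + (𝟙 xs + - R)               ≈⟨ +-assoc _ _ _ ⟨
      R + 𝟙 xs + - R                 ≈⟨ xyx⁻¹≈y R (𝟙 xs) ⟩
      𝟙 xs ∎
      where
      R : C
      R = rest (iterate (length xs)) xs
      ψ≈iterate : ∀ ys → length ys < length xs → ψ ys ≈ iterate (length xs) ys
      ψ≈iterate ys |ys|<|xs| = iterate-stable′ ys ≤-refl (≤⇒≤′ |ys|<|xs|)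

    ψ[]≈c : ψ [] ≈ c
    ψ[]≈c = begin
      (1# + - (0# + 0#)) * c  ≈⟨ *-congʳ (+-congˡ (trans (-‿cong (+-identityʳ 0#)) ε⁻¹≈ε)) ⟩
      (1# + 0#) * c           ≈⟨ *-congʳ (+-identityʳ 1#) ⟩
      1# * c                  ≈⟨ *-identityˡ c ⟩
      c ∎

  S-equation-solvable : ∀ {φ} → Multilinear φ → IsInvertibleElem (φ []) →
    Σ Series λ ψ → Multilinear ψ × IsInvertibleElem (ψ []) × ψ ⊙ (φ ⊚ (𝕀 ⊙ ψ)) ≈ₛ 𝟙
  S-equation-solvable {φ} φ-ml (c , c*φ[]≈1 , φ[]*c≈1) =
    ψ , ψ-multilinear , (φ [] , trans (*-congˡ ψ[]≈c) φ[]*c≈1 , trans (*-congʳ ψ[]≈c) c*φ[]≈1) , ψ-solves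
    where open SEquationSolution φ-ml c c*φ[]≈1

  ⊚-invertible : ∀ {φ} → Multilinear φ → IsInvertibleElem (φ []) →
    Σ Series λ ψ → Multilinear ψ × (𝕀 ⊙ φ) ⊚ (𝕀 ⊙ ψ) ≈ₛ 𝕀 × (𝕀 ⊙ ψ) ⊚ (𝕀 ⊙ φ) ≈ₛ 𝕀
  ⊚-invertible {φ} φ-ml φ[]-inv =
    let ψ , ψ-ml , ψ[]-inv , ψ-solves = S-equation-solvable φ-ml φ[]-inv
        ζ , _    , _       , ζ-solves = S-equation-solvable ψ-ml ψ[]-inv
        φψ≈𝕀 : (𝕀 ⊙ φ) ⊚ (𝕀 ⊙ ψ) ≈ₛ 𝕀
        φψ≈𝕀 = S-equation⇒⊚-inverseʳ ψ-solves
        ψζ≈𝕀 : (𝕀 ⊙ ψ) ⊚ (𝕀 ⊙ ζ) ≈ₛ 𝕀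
        ψζ≈𝕀 = S-equation⇒⊚-inverseʳ ζ-solves
        ζ≈φ : 𝕀 ⊙ ζ ≈ₛ 𝕀 ⊙ φ
        ζ≈φ = ⊚-inverse-unique (𝕀⊙-multilinear φ-ml) (𝕀⊙-[] ζ) φψ≈𝕀 ψζ≈𝕀
    in ψ , ψ-ml , φψ≈𝕀 ,
       λ xs → trans (⊚-congˡ (𝕀⊙-multilinear ψ-ml) (λ ys → sym (ζ≈φ ys)) xs) (ψζ≈𝕀 xs)

  ⊚-inverse⇒S-equationˡ : ∀ {φ s} → (𝕀 ⊙ φ) ⊚ (𝕀 ⊙ s) ≈ₛ 𝕀 → (𝕀 ⊙ s) ⊚ (𝕀 ⊙ φ) ≈ₛ 𝕀 →
                          (φ ⊚ (𝕀 ⊙ s)) ⊙ s ≈ₛ 𝟙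
  ⊚-inverse⇒S-equationˡ {φ} {s} φs≈𝕀 sφ≈𝕀 xs = begin
    (X ⊙ s) xs   ≈⟨ ⊙-congˡ s≈Y xs ⟩
    (X ⊙ Y) xs   ≈⟨ XY≈𝟙 xs ⟩
    𝟙 xs ∎
    where
    X Y : Series
    X = φ ⊚ (𝕀 ⊙ s)
    Y = (s ⊚ (𝕀 ⊙ φ)) ⊚ (𝕀 ⊙ s)
    XY≈𝟙 : X ⊙ Y ≈ₛ 𝟙
    XY≈𝟙 ys = begin
      (X ⊙ Y) ys                            ≈⟨ ⊚-distribʳ-⊙ φ (s ⊚ (𝕀 ⊙ φ)) (𝕀 ⊙ s) ys ⟨
      ((φ ⊙ (s ⊚ (𝕀 ⊙ φ))) ⊚ (𝕀 ⊙ s)) ys    ≈⟨ ⊚-congʳ (𝕀 ⊙ s) (⊚-inverseʳ⇒S-equation sφ≈𝕀) ys ⟩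
      (𝟙 ⊚ (𝕀 ⊙ s)) ys                      ≈⟨ 𝟙-⊚ (𝕀 ⊙ s) ys ⟩
      𝟙 ys ∎
    s≈Y : s ≈ₛ Y
    s≈Y = ⊙-inverse-unique (⊚-inverseʳ⇒S-equation φs≈𝕀) XY≈𝟙

  S-equation-unique : ∀ {φ s g} → Multilinear s → (𝕀 ⊙ s) ⊚ (𝕀 ⊙ φ) ≈ₛ 𝕀 →
                      g ⊙ (φ ⊚ (𝕀 ⊙ g)) ≈ₛ 𝟙 → g ≈ₛ s
  S-equation-unique {g = g} s-ml sφ≈𝕀 g-solves = 𝕀⊙-cancel
    (⊚-inverse-unique (𝕀⊙-multilinear s-ml) (𝕀⊙-[] g) sφ≈𝕀 (S-equation⇒⊚-inverseʳ g-solves))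

module Transfer {k kℓ b bℓ} {K : Field k kℓ} (B : UnitalAlgebra K b bℓ) where

  open UnitalAlgebra B renaming (Carrier to C)
  open MultSeries B hiding (splits; blocks)
  open Series B
  open Multilinear
  open IsLinear

  splits-≡ : ∀ xs → MultSeries.splits B xs ≡ splits xs
  splits-≡ []       = ≡.refl
  splits-≡ (x ∷ xs) = ≡.cong (([] , x ∷ xs) ∷_) (≡.cong (map (map₁ (x ∷_))) (splits-≡ xs))

  blocks-≡ : ∀ xs → MultSeries.blocks B xs ≡ blocks xs
  blocks-≡ []       = ≡.refl
  blocks-≡ (x ∷ xs) =
    ≡.trans (List.concatMap-cong {g = placements x} (λ { [] → ≡.refl ; (_ ∷ _) → ≡.refl })
                                 (MultSeries.blocks B xs))
            (≡.cong (concatMap (placements x)) (blocks-≡ xs))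

  app-· : ∀ F G → app (F · G) ≈ₛ app F ⊙ app G
  app-· F G xs = reflexive (≡.cong (∑ (λ s → app F (proj₁ s) * app G (proj₂ s)))
    (≡.trans (≡.cong (MultSeries.splits B) (toList∘fromList xs)) (splits-≡ xs)))

  app-∘ : ∀ F G → app (F ∘ G) ≈ₛ app F ⊚ app G
  app-∘ F G xs = reflexive (≡.cong (∑ (λ p → app F (map (app G) p)))
    (≡.trans (≡.cong (MultSeries.blocks B) (toList∘fromList xs)) (blocks-≡ xs)))

  app-I : app I ≈ₛ 𝕀
  app-I []          = refl
  app-I (_ ∷ [])    = refl
  app-I (_ ∷ _ ∷ _) = refl

  app-one : app one ≈ₛ 𝟙
  app-one []      = refl
  app-one (_ ∷ _) = refl

  app-·-cong : ∀ F G {f g} → app F ≈ₛ f → app G ≈ₛ g → app (F · G) ≈ₛ f ⊙ g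
  app-·-cong F G F≈f G≈g xs = trans (app-· F G xs) (⊙-cong F≈f G≈g xs)

  app-∘-cong : ∀ F G {f g} → Multilinear f → app F ≈ₛ f → app G ≈ₛ g → app (F ∘ G) ≈ₛ f ⊚ g
  app-∘-cong F G f-ml F≈f G≈g xs =
    trans (app-∘ F G xs) (trans (⊚-congʳ (app G) F≈f xs) (⊚-congˡ f-ml G≈g xs))

  app-I· : ∀ F {f} → app F ≈ₛ f → app (I · F) ≈ₛ 𝕀 ⊙ f
  app-I· F = app-·-cong I F app-I

  app-toList : ∀ (F : Seq) n (xs : Vec C n) → app F (toList xs) ≡ F n xs
  app-toList F zero    Vec.[]         = ≡.refl
  app-toList F (suc n) (x Vec.∷ xs) = app-toList (λ m ys → F (suc m) (x Vec.∷ ys)) n xs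

  app-≋ : ∀ {F G} → F ≋ G → app F ≈ₛ app G
  app-≋ F≋G xs = F≋G _ (fromList xs)

  ≋-app : ∀ {F G} → app F ≈ₛ app G → F ≋ G
  ≋-app {F} {G} F≈G n xs =
    trans (reflexive (≡.sym (app-toList F n xs))) (trans (F≈G (toList xs)) (reflexive (app-toList G n xs)))

  LinearInEachSlot : Seq → Set (k ⊔ b ⊔ bℓ)
  LinearInEachSlot F = ∀ n (xs : Vec C n) i → IsLinear (λ w → F n (xs [ i ]≔ w))

  Pointwise-[]≔ : ∀ {n} (xs : Vec C n) i {y z} → y ≈ z → Pointwise _≈_ (xs [ i ]≔ y) (xs [ i ]≔ z)
  Pointwise-[]≔ (x Vec.∷ xs) fzero    y≈z = y≈z Pointwise.∷ Pointwise.refl refl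
  Pointwise-[]≔ (x Vec.∷ xs) (fsuc i) y≈z = refl Pointwise.∷ Pointwise-[]≔ xs i y≈z

  IsMult⇒linearInEachSlot : ∀ {F} → IsMult F → LinearInEachSlot F
  IsMult⇒linearInEachSlot F-mult n xs i = record
    { cong   = λ y≈z → proj₁ (F-mult n) (Pointwise-[]≔ xs i y≈z)
    ; +-homo = proj₁ (proj₂ (F-mult n)) xs i
    ; •-homo = proj₂ (proj₂ (F-mult n)) xs i
    }

  app-linearAt : ∀ {F} → LinearInEachSlot F → ∀ xs ys → IsLinear (λ w → app F (xs ++ w ∷ ys))
  app-linearAt F-lin []       ys = F-lin _ (0# Vec.∷ fromList ys) fzero
  app-linearAt {F} F-lin (x ∷ xs) ys =
    app-linearAt {λ m zs → F (suc m) (x Vec.∷ zs)} (λ n zs i → F-lin (suc n) (x Vec.∷ zs) (fsuc i)) xs ys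

  IsMult⇒Multilinear : ∀ F → IsMult F → Multilinear (app F)
  IsMult⇒Multilinear F F-mult = multilinear (app-linearAt {F} (IsMult⇒linearInEachSlot F-mult))

  toSeq : Series → Seq
  toSeq ψ n xs = ψ (toList xs)

  app-toSeq : ∀ ψ → app (toSeq ψ) ≈ₛ ψ
  app-toSeq ψ xs = reflexive (≡.cong ψ (toList∘fromList xs))

  toList-[]≔ : ∀ {n} (xs : Vec C n) i → ∃₂ λ ys zs → ∀ v → toList (xs [ i ]≔ v) ≡ ys ++ v ∷ zs
  toList-[]≔ (x Vec.∷ xs) fzero    = [] , toList xs , λ v → ≡.refl
  toList-[]≔ (x Vec.∷ xs) (fsuc i) with toList-[]≔ xs i
  ... | ys , zs , eq = x ∷ ys , zs , λ v → ≡.cong (x ∷_) (eq v)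

  multilinear-Pointwise : ∀ {ψ} → Multilinear ψ → ∀ {m n} {xs : Vec C m} {ys : Vec C n} →
                          Pointwise _≈_ xs ys → ψ (toList xs) ≈ ψ (toList ys)
  multilinear-Pointwise ψ-ml Pointwise.[] = refl
  multilinear-Pointwise ψ-ml {xs = _ Vec.∷ xs} {ys = y Vec.∷ _} (x≈y Pointwise.∷ xs≈ys) =
    trans (cong (linearAt ψ-ml [] (toList xs)) x≈y) (multilinear-Pointwise (multilinear-∷ y ψ-ml) xs≈ys)

  Multilinear⇒linearInEachSlot : ∀ {ψ} → Multilinear ψ → LinearInEachSlot (toSeq ψ)
  Multilinear⇒linearInEachSlot {ψ} ψ-ml n xs i with toList-[]≔ xs i
  ... | ys , zs , eq = isLinear-resp (λ v → reflexive (≡.cong ψ (≡.sym (eq v)))) (linearAt ψ-ml ys zs)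

  Multilinear⇒IsMult : ∀ {ψ} → Multilinear ψ → IsMult (toSeq ψ)
  Multilinear⇒IsMult {ψ} ψ-ml n =
    multilinear-Pointwise ψ-ml , (λ xs i → +-homo (slot xs i)) , (λ xs i → •-homo (slot xs i))
    where
    slot : ∀ (xs : Vec C n) i → IsLinear (λ w → ψ (toList (xs [ i ]≔ w)))
    slot = Multilinear⇒linearInEachSlot ψ-ml n

  ⊚-inverse⇒compInverse : ∀ F S {f s} → Multilinear f → Multilinear s → app F ≈ₛ f → app S ≈ₛ s →
    (𝕀 ⊙ f) ⊚ (𝕀 ⊙ s) ≈ₛ 𝕀 → (𝕀 ⊙ s) ⊚ (𝕀 ⊙ f) ≈ₛ 𝕀 → IsCompInverse (I · S) (I · F)
  ⊚-inverse⇒compInverse F S f-ml s-ml F≈f S≈s fs≈𝕀 sf≈𝕀 =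
    ≋-app (λ xs → trans (app-∘-cong (I · F) (I · S) (𝕀⊙-multilinear f-ml) (app-I· F F≈f) (app-I· S S≈s) xs)
                        (trans (fs≈𝕀 xs) (sym (app-I xs)))) ,
    ≋-app (λ xs → trans (app-∘-cong (I · S) (I · F) (𝕀⊙-multilinear s-ml) (app-I· S S≈s) (app-I· F F≈f) xs)
                        (trans (sf≈𝕀 xs) (sym (app-I xs))))

  compInverse⇒⊚-inverse : ∀ {F S} → IsMult F → IsMult S → IsCompInverse (I · S) (I · F) →
    (𝕀 ⊙ app F) ⊚ (𝕀 ⊙ app S) ≈ₛ 𝕀 × (𝕀 ⊙ app S) ⊚ (𝕀 ⊙ app F) ≈ₛ 𝕀
  compInverse⇒⊚-inverse {F} {S} F-mult S-mult (FS≋I , SF≋I) =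
    (λ xs → trans (sym (app-∘-cong (I · F) (I · S) (𝕀⊙-multilinear (IsMult⇒Multilinear F F-mult)) F≈ S≈ xs))
                  (trans (app-≋ FS≋I xs) (app-I xs))) ,
    (λ xs → trans (sym (app-∘-cong (I · S) (I · F) (𝕀⊙-multilinear (IsMult⇒Multilinear S S-mult)) S≈ F≈ xs))
                  (trans (app-≋ SF≋I xs) (app-I xs)))
    where
    F≈ : app (I · F) ≈ₛ 𝕀 ⊙ app F
    F≈ = app-I· F (λ _ → refl)
    S≈ : app (I · S) ≈ₛ 𝕀 ⊙ app S
    S≈ = app-I· S (λ _ → refl)

  app-∘-I· : ∀ F G → IsMult F → app (F ∘ (I · G)) ≈ₛ app F ⊚ (𝕀 ⊙ app G)
  app-∘-I· F G F-mult = app-∘-cong F (I · G) (IsMult⇒Multilinear F F-mult) (λ _ → refl) (app-I· G (λ _ → refl))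

  compInverse-exists : ∀ {F} → IsMult F → InGinv F → Σ Seq (λ S → IsMult S × IsCompInverse (I · S) (I · F))
  compInverse-exists {F} F-mult F₀-inv =
    let ψ , ψ-ml , fψ≈𝕀 , ψf≈𝕀 = ⊚-invertible (IsMult⇒Multilinear F F-mult) F₀-inv
    in toSeq ψ , Multilinear⇒IsMult ψ-ml ,
       ⊚-inverse⇒compInverse F (toSeq ψ) (IsMult⇒Multilinear F F-mult) ψ-ml (λ _ → refl) (app-toSeq ψ) fψ≈𝕀 ψf≈𝕀

  S-transform-equation : ∀ {F S} → IsMult F → IsMult S → IsCompInverse (I · S) (I · F) →
                         IsMulInverse S (F ∘ (I · S))
  S-transform-equation {F} {S} F-mult S-mult S-inv =
    let fs≈𝕀 , sf≈𝕀 = compInverse⇒⊚-inverse F-mult S-mult S-inv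
    in ≋-app (λ xs → trans (app-·-cong S (F ∘ (I · S)) (λ _ → refl) X≈ xs)
                           (trans (⊚-inverseʳ⇒S-equation fs≈𝕀 xs) (sym (app-one xs)))) ,
       ≋-app (λ xs → trans (app-·-cong (F ∘ (I · S)) S X≈ (λ _ → refl) xs)
                           (trans (⊚-inverse⇒S-equationˡ fs≈𝕀 sf≈𝕀 xs) (sym (app-one xs))))
    where
    X≈ : app (F ∘ (I · S)) ≈ₛ app F ⊚ (𝕀 ⊙ app S)
    X≈ = app-∘-I· F S F-mult

  S-transform-unique : ∀ {F S} → IsMult F → IsMult S → IsCompInverse (I · S) (I · F) →
                       ∀ g → IsMulInverse g (F ∘ (I · g)) → g ≋ S
  S-transform-unique {F} {S} F-mult S-mult S-inv g (g·X≋one , _) =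
    ≋-app (S-equation-unique (IsMult⇒Multilinear S S-mult) (proj₂ (compInverse⇒⊚-inverse F-mult S-mult S-inv))
      (λ xs → trans (sym (app-·-cong g (F ∘ (I · g)) (λ _ → refl) (app-∘-I· F g F-mult) xs))
                    (trans (app-≋ g·X≋one xs) (app-one xs))))

lemma3p5 : ∀ {k kℓ b bℓ} (K : Field k kℓ) → CharacteristicZero K →
    (B : UnitalAlgebra K b bℓ) →
    let open MultSeries B in
    (F : Seq) → IsMult F → InGinv F →
      -- f = I·F has a compositional inverse of the form I·S with S ∈ Mult[[B]]
      Σ Seq (λ S → IsMult S × IsCompInverse (I · S) (I · F))
    × (∀ (S : Seq) → IsMult S → IsCompInverse (I · S) (I · F) →
      -- S = S_f satisfies S_f = inverse of F ∘ (I·S_f) ...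
        IsMulInverse S (F ∘ (I · S))
      -- ... and is the unique g ∈ Mult[[B]] with g = inverse of F ∘ (I·g)
      × (∀ (g : Seq) → IsMult g → IsMulInverse g (F ∘ (I · g)) → g ≋ S))
lemma3p5 K _ B F F-mult F₀-inv =
  compInverse-exists F-mult F₀-inv ,
  λ S S-mult S-inv →
    S-transform-equation F-mult S-mult S-inv ,
    λ g _ g-inv → S-transform-unique F-mult S-mult S-inv g g-inv
  where open Transfer B
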